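{- For every strict partition $\lambda$, $$K_\lambda(x_1,x_2,\ldots)=(-1)^{|\lambda|}\,GP_\lambda\!\left(\frac{ -x_1}{1-x_1},\frac{ -x_2}{1-x_2},\ldots\right),$$ where $|\lambda|$ is the number of boxes of $\lambda$.
   Context: A strict partition $\lambda$ gives a shifted shape with boxes $(i,j)$, $i\le j\le i+\lambda_i-1$; boxes $(i,i)$ form the main diagonal. Use the ordered alphabet $1'<1<2'<2<\cdots$. A set-valued shifted tableau (resp. weak set-valued shifted tableau) of shape $\lambda$ fills each box with a finite nonempty set (resp. multiset) of letters of this alphabet such that: (1) the smallest entry of a box is $\ge$ the largest entry of the box directly to its left; (2) the smallest entry of a box is $\ge$ the largest entry of the box directly above; (3) there are no primed entries on the main diagonal; (4) each unprimed integer appears in at most one box of each column; (5) each primed integer appears in at most one box of each row. For such a $T$, $x^T=\prod_i x_i^{a_i}$ with $a_i$ the number of occurrences (with multiplicity) of $i$ and $i'$ in $T$, and $|T|$ is the degree of $x^T$. Define $K_\lambda=\sum_T x^T$ over weak set-valued shifted tableaux of shape $\lambda$, and $GP_\lambda=\sum_T(-1)^{|T|-|\lambda|}x^T$ over set-valued shifted tableaux of shape $\lambda$. -}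

module Defs where

open import Data.Bool using (Bool; true; false; _∧_; _∨_; not; if_then_else_)
open import Data.Nat as ℕ using (ℕ; zero; suc; _+_; _*_; _∸_; _<_; _≤ᵇ_; _<ᵇ_; _≡ᵇ_; ⌊_/2⌋)
open import Data.Integer as ℤ using (ℤ)
open import Data.List using (List; []; _∷_; _++_; map; concatMap; upTo; length; filterᵇ; foldr)
open import Data.Bool.ListAction using (all; any)
open import Data.Nat.ListAction using (sum)
open import Data.Product using (_×_; _,_)

data StrictPartition : List ℕ → Set where
  []  : StrictPartition []
  [_] : ∀ {x} → 0 < x → StrictPartition (x ∷ [])
  _∷_ : ∀ {x y xs} → y < x → StrictPartition (y ∷ xs) → StrictPartition (x ∷ y ∷ xs)

size : List ℕ → ℕ
size = sum

-- Shifted shape (0-indexed): boxes (i , j) with i ≤ j ≤ i + λ_i - 1.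

Box : Set
Box = ℕ × ℕ

boxesFrom : ℕ → List ℕ → List Box
boxesFrom i []       = []
boxesFrom i (l ∷ ls) = map (λ k → (i , i + k)) (upTo l) ++ boxesFrom (suc i) ls

shape : List ℕ → List Box
shape = boxesFrom 0

-- Alphabet 1' < 1 < 2' < 2 < ⋯ encoded in ℕ:
--   code 2k   ↦ (k+1)'   (primed)
--   code 2k+1 ↦ k+1      (unprimed)
-- so the order of the alphabet is the order of ℕ.  With n variables the
-- letters are the codes 0 … 2n-1.

isPrimed : ℕ → Bool
isPrimed zero          = true
isPrimed (suc zero)    = false
isPrimed (suc (suc m)) = isPrimed m

letters : ℕ → List ℕ
letters n = upTo (2 * n)

-- The content of a box is a finite multiset of letters, given by its
-- multiplicity list: position p holds the multiplicity of letter p.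
Content : Set
Content = List ℕ

mult : Content → ℕ → ℕ
mult []       _       = 0
mult (c ∷ cs) zero    = c
mult (c ∷ cs) (suc p) = mult cs p

occurs : Content → ℕ → Bool
occurs c p = 0 <ᵇ mult c p

Filling : Set
Filling = List (Box × Content)

allPairs : Filling → ((Box × Content) → (Box × Content) → Bool) → Bool
allPairs F P = all (λ e → all (λ e' → P e e') F) F

leqAll : ℕ → Content → Content → Bool
leqAll n c d = all (λ p → all (λ q → not (occurs c p ∧ occurs d q) ∨ (p ≤ᵇ q)) (letters n)) (letters n)

nonempty : ℕ → Content → Bool
nonempty n c = any (occurs c) (letters n)

isSet : ℕ → Content → Bool
isSet n c = all (λ p → mult c p ≤ᵇ 1) (letters n)

rowColOrder : ℕ → Filling → Bool
rowColOrder n F = allPairs F λ { ((i , j) , c) ((i' , j') , d) →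
  not (((i ≡ᵇ i') ∧ (suc j ≡ᵇ j')) ∨ ((suc i ≡ᵇ i') ∧ (j ≡ᵇ j'))) ∨ leqAll n c d }

noPrimedDiag : ℕ → Filling → Bool
noPrimedDiag n F = all (λ { ((i , j) , c) →
  not (i ≡ᵇ j) ∨ all (λ p → not (isPrimed p ∧ occurs c p)) (letters n) }) F

colUnprimed : ℕ → Filling → Bool
colUnprimed n F = allPairs F λ { ((i , j) , c) ((i' , j') , d) →
  not ((j ≡ᵇ j') ∧ not (i ≡ᵇ i')) ∨
  all (λ p → not (not (isPrimed p) ∧ occurs c p ∧ occurs d p)) (letters n) }

rowPrimed : ℕ → Filling → Bool
rowPrimed n F = allPairs F λ { ((i , j) , c) ((i' , j') , d) →
  not ((i ≡ᵇ i') ∧ not (j ≡ᵇ j')) ∨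
  all (λ p → not (isPrimed p ∧ occurs c p ∧ occurs d p)) (letters n) }

isWeakSVST : ℕ → Filling → Bool
isWeakSVST n F = all (λ { (_ , c) → nonempty n c }) F ∧ rowColOrder n F
                 ∧ noPrimedDiag n F ∧ colUnprimed n F ∧ rowPrimed n F

isSVST : ℕ → Filling → Bool
isSVST n F = all (λ { (_ , c) → isSet n c }) F ∧ isWeakSVST n F

-- a_k(T): number of occurrences of k+1 and (k+1)' (with multiplicity)
wt : Filling → ℕ → ℕ
wt F k = sum (map (λ { (_ , c) → mult c (2 * k) + mult c (suc (2 * k)) }) F)

total : Filling → ℕ
total F = sum (map (λ { (_ , c) → sum c }) F)

hasWeight : List ℕ → Filling → Bool
hasWeight a F = all (λ k → wt F k ≡ᵇ mult a k) (upTo (length a))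

boundedLists : List ℕ → List (List ℕ)
boundedLists []       = [] ∷ []
boundedLists (b ∷ bs) = concatMap (λ x → map (x ∷_) (boundedLists bs)) (upTo (suc b))

fillings : List Box → List Content → List Filling
fillings []       cs = [] ∷ []
fillings (b ∷ bs) cs = concatMap (λ c → map ((b , c) ∷_) (fillings bs cs)) cs

weakBounds : List ℕ → List ℕ
weakBounds = concatMap (λ x → x ∷ x ∷ [])

setBounds : List ℕ → List ℕ
setBounds a = map (ℕ._⊓ 1) (weakBounds a)

-- Coefficient of x^a = x₁^{a₁} ⋯ x_n^{a_n} in K_λ: the number of weak
-- set-valued shifted tableaux of shape λ with x^T = x^a.  (Every such
-- tableau has all multiplicities ≤ a_k, so the enumeration is complete.)

coeffK : List ℕ → List ℕ → ℕ
coeffK la a = length (filterᵇ (λ F → isWeakSVST (length a) F ∧ hasWeight a F)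
                              (fillings (shape la) (boundedLists (weakBounds a))))

Series : Set
Series = ℕ → ℤ

sumTo : ℕ → (ℕ → ℤ) → ℤ
sumTo zero    f = f 0
sumTo (suc m) f = sumTo m f ℤ.+ f (suc m)

_⊛_ : Series → Series → Series
(f ⊛ g) m = sumTo m (λ k → f k ℤ.* g (m ∸ k))

one : Series
one zero    = ℤ.1ℤ
one (suc _) = ℤ.0ℤ

_^ˢ_ : Series → ℕ → Series
f ^ˢ zero  = one
f ^ˢ suc b = f ⊛ (f ^ˢ b)

-- y(x) = -x / (1 - x) = -x - x² - x³ - ⋯
ySeries : Series
ySeries zero    = ℤ.0ℤ
ySeries (suc _) = ℤ.-1ℤ

signPow : ℕ → ℤ
signPow zero    = ℤ.1ℤ
signPow (suc k) = ℤ.- signPow k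

prodZ : List ℤ → ℤ
prodZ = foldr ℤ._*_ ℤ.1ℤ

-- Coefficient of x^a in GP_λ(y(x₁), y(x₂), …), where
--   GP_λ(y) = Σ_T (-1)^{|T|-|λ|} Π_k y_k^{a_k(T)}   (T set-valued),
-- so  [x^a] = Σ_T (-1)^{|T|-|λ|} Π_k [x^{a_k}] y(x)^{a_k(T)}.
-- Only tableaux with letters ≤ n = length a and all multiplicities ≤ a_k
-- can contribute (y has no constant term); all of these are enumerated
-- (some enumerated T with a_k(T) > a_k contribute 0).

coeffGPsub : List ℕ → List ℕ → ℤ
coeffGPsub la a =
  sum' (map (λ F → signPow (total F ∸ size la)
                   ℤ.* prodZ (map (λ k → (ySeries ^ˢ wt F k) (mult a k)) (upTo (length a))))
            (filterᵇ (isSVST (length a)) (fillings (shape la) (boundedLists (setBounds a)))))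
  where
    sum' : List ℤ → ℤ
    sum' = foldr ℤ._+_ ℤ.0ℤ

-- A weak set-valued shifted tableau F determines a set-valued one S, its support, by
-- forgetting multiplicities, and all five tableau conditions only see which letters
-- occur in which box; so F ↦ S is onto the set-valued tableaux, and the fibre over S
-- consists of all ways to give each entry of S a positive multiplicity.  The entries
-- equal to i or i′ contribute x_i/(1 - x_i) = -y(x_i) each, hence
--   K_λ = Σ_S Π_i (-y(x_i))^{a_i(S)} = Σ_S (-1)^{|S|} y^S = (-1)^{|λ|} GP_λ(y).
-- On coefficients: [x^t] y(x)^β = (-1)^β · #{compositions of t into β positive parts},
-- and these compositions are exactly the multiplicity choices for one letter.

module Submission where

open import Defs
open import Algebra.Properties.CommutativeSemigroup using (interchange; xy∙z≈y∙xz)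
open import Data.Bool using (Bool; true; false; T; _∧_; _∨_; not; if_then_else_)
open import Data.Bool.Properties using (T-∧; T-≡)
open import Data.Bool.ListAction using (all; any)
open import Data.Integer as ℤ using (ℤ)
import Data.Integer.Properties as ℤ
open import Data.List using (List; []; _∷_; _++_; map; concatMap; upTo; applyUpTo; length; filterᵇ; foldr; drop)
import Data.List.Properties as List
open import Data.List.Relation.Binary.Pointwise using (Pointwise; []; _∷_; Pointwise-length)
open import Data.List.Relation.Unary.All as All using (All; []; _∷_)
import Data.List.Relation.Unary.All.Properties as All
open import Data.List.Relation.Unary.Any using (satisfied)
import Data.List.Relation.Unary.Any.Properties as Any
open import Data.Nat using (ℕ; zero; suc; _+_; _*_; _∸_; _≤_; _<_; z≤n; s≤s; _≤ᵇ_; _<ᵇ_; _≡ᵇ_; _⊓_)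
open import Data.Nat.ListAction using (sum)
open import Data.Nat.Properties
open import Data.Product using (_×_; _,_; proj₁; proj₂)
open import Function using (_∘_; id; Equivalence)
open import Relation.Binary.PropositionalEquality

private variable
  A B : Set

∑ : List A → (A → ℕ) → ℕ
∑ []       f = 0
∑ (x ∷ xs) f = f x + ∑ xs f

∑-++ : (xs ys : List A) (f : A → ℕ) → ∑ (xs ++ ys) f ≡ ∑ xs f + ∑ ys f
∑-++ []       ys f = refl
∑-++ (x ∷ xs) ys f = trans (cong (f x +_) (∑-++ xs ys f)) (sym (+-assoc (f x) _ _))

∑-map : (g : A → B) (xs : List A) (f : B → ℕ) → ∑ (map g xs) f ≡ ∑ xs (f ∘ g)
∑-map g []       f = refl
∑-map g (x ∷ xs) f = cong (f (g x) +_) (∑-map g xs f)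

∑-concatMap : (g : A → List B) (xs : List A) (f : B → ℕ) →
  ∑ (concatMap g xs) f ≡ ∑ xs (λ x → ∑ (g x) f)
∑-concatMap g []       f = refl
∑-concatMap g (x ∷ xs) f =
  trans (∑-++ (g x) (concatMap g xs) f) (cong (∑ (g x) f +_) (∑-concatMap g xs f))

∑-cong : (xs : List A) {f g : A → ℕ} → (∀ x → f x ≡ g x) → ∑ xs f ≡ ∑ xs g
∑-cong []       e = refl
∑-cong (x ∷ xs) e = cong₂ _+_ (e x) (∑-cong xs e)

∑-congᴬ : {P : A → Set} {xs : List A} {f g : A → ℕ} →
  All P xs → (∀ x → P x → f x ≡ g x) → ∑ xs f ≡ ∑ xs g
∑-congᴬ []                 e = refl
∑-congᴬ {xs = x ∷ _} (px ∷ ps) e = cong₂ _+_ (e x px) (∑-congᴬ ps e)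

∑-zero : (xs : List A) {f : A → ℕ} → (∀ x → f x ≡ 0) → ∑ xs f ≡ 0
∑-zero []       e = refl
∑-zero (x ∷ xs) e = cong₂ _+_ (e x) (∑-zero xs e)

∑-distrib-+ : (xs : List A) (f g : A → ℕ) → ∑ xs (λ x → f x + g x) ≡ ∑ xs f + ∑ xs g
∑-distrib-+ []       f g = refl
∑-distrib-+ (x ∷ xs) f g = trans (cong (f x + g x +_) (∑-distrib-+ xs f g))
  (interchange +-commutativeSemigroup (f x) (g x) _ _)

∑-comm : (xs : List A) (ys : List B) (f : A → B → ℕ) →
  ∑ xs (λ x → ∑ ys (f x)) ≡ ∑ ys (λ y → ∑ xs (λ x → f x y))
∑-comm []       ys f = sym (∑-zero ys (λ _ → refl))
∑-comm (x ∷ xs) ys f = trans (cong (∑ ys (f x) +_) (∑-comm xs ys f))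
  (sym (∑-distrib-+ ys (f x) (λ y → ∑ xs (λ x′ → f x′ y))))

*-distribˡ-∑ : (c : ℕ) (xs : List A) (f : A → ℕ) → c * ∑ xs f ≡ ∑ xs (λ x → c * f x)
*-distribˡ-∑ c []       f = *-zeroʳ c
*-distribˡ-∑ c (x ∷ xs) f = trans (*-distribˡ-+ c (f x) _) (cong (c * f x +_) (*-distribˡ-∑ c xs f))

*-distribʳ-∑ : (c : ℕ) (xs : List A) (f : A → ℕ) → ∑ xs f * c ≡ ∑ xs (λ x → f x * c)
*-distribʳ-∑ c []       f = refl
*-distribʳ-∑ c (x ∷ xs) f = trans (*-distribʳ-+ c (f x) _) (cong (f x * c +_) (*-distribʳ-∑ c xs f))

⟦_⟧ : Bool → ℕ
⟦ true  ⟧ = 1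
⟦ false ⟧ = 0

⟦∧⟧ : ∀ b b′ → ⟦ b ∧ b′ ⟧ ≡ ⟦ b ⟧ * ⟦ b′ ⟧
⟦∧⟧ true  b′ = sym (+-identityʳ _)
⟦∧⟧ false b′ = refl

length-filterᵇ : (p : A → Bool) (xs : List A) → length (filterᵇ p xs) ≡ ∑ xs (λ x → ⟦ p x ⟧)
length-filterᵇ p []       = refl
length-filterᵇ p (x ∷ xs) with p x
... | true  = cong suc (length-filterᵇ p xs)
... | false = length-filterᵇ p xs

∑< : ℕ → (ℕ → ℕ) → ℕ
∑< zero    f = 0
∑< (suc n) f = f 0 + ∑< n (f ∘ suc)

∏< : ℕ → (ℕ → ℕ) → ℕ
∏< zero    f = 1
∏< (suc n) f = f 0 * ∏< n (f ∘ suc)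

∑<-cong : ∀ n {f g : ℕ → ℕ} → (∀ k → k < n → f k ≡ g k) → ∑< n f ≡ ∑< n g
∑<-cong zero    e = refl
∑<-cong (suc n) e = cong₂ _+_ (e 0 (s≤s z≤n)) (∑<-cong n (λ k k<n → e (suc k) (s≤s k<n)))

∏<-cong : ∀ n {f g : ℕ → ℕ} → (∀ k → f k ≡ g k) → ∏< n f ≡ ∏< n g
∏<-cong zero    e = refl
∏<-cong (suc n) e = cong₂ _*_ (e 0) (∏<-cong n (e ∘ suc))

∑<-zero : ∀ n {f : ℕ → ℕ} → (∀ k → f k ≡ 0) → ∑< n f ≡ 0
∑<-zero zero    e = refl
∑<-zero (suc n) e = cong₂ _+_ (e 0) (∑<-zero n (e ∘ suc))

∑<-+ : ∀ m r f → ∑< (m + r) f ≡ ∑< m f + ∑< r (λ k → f (m + k))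
∑<-+ zero    r f = refl
∑<-+ (suc m) r f = trans (cong (f 0 +_) (∑<-+ m r (f ∘ suc))) (sym (+-assoc (f 0) _ _))

∑<-distrib-+ : ∀ n (f g : ℕ → ℕ) → ∑< n (λ k → f k + g k) ≡ ∑< n f + ∑< n g
∑<-distrib-+ zero    f g = refl
∑<-distrib-+ (suc n) f g = trans (cong (f 0 + g 0 +_) (∑<-distrib-+ n (f ∘ suc) (g ∘ suc)))
  (interchange +-commutativeSemigroup (f 0) (g 0) _ _)

∑-applyUpTo : (g : ℕ → ℕ) (n : ℕ) (f : ℕ → ℕ) → ∑ (applyUpTo g n) f ≡ ∑< n (f ∘ g)
∑-applyUpTo g zero    f = refl
∑-applyUpTo g (suc n) f = cong (f (g 0) +_) (∑-applyUpTo (g ∘ suc) n f)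

⟦all-applyUpTo⟧ : (g : ℕ → ℕ) (n : ℕ) (p : ℕ → Bool) →
  ⟦ all p (applyUpTo g n) ⟧ ≡ ∏< n (λ k → ⟦ p (g k) ⟧)
⟦all-applyUpTo⟧ g zero    p = refl
⟦all-applyUpTo⟧ g (suc n) p =
  trans (⟦∧⟧ (p (g 0)) _) (cong (⟦ p (g 0) ⟧ *_) (⟦all-applyUpTo⟧ (g ∘ suc) n p))

∑ℤ : List A → (A → ℤ) → ℤ
∑ℤ []       f = ℤ.0ℤ
∑ℤ (x ∷ xs) f = f x ℤ.+ ∑ℤ xs f

∑ℤ-congᴬ : {P : A → Set} {xs : List A} {f g : A → ℤ} →
  All P xs → (∀ x → P x → f x ≡ g x) → ∑ℤ xs f ≡ ∑ℤ xs g
∑ℤ-congᴬ []                 e = refl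
∑ℤ-congᴬ {xs = x ∷ _} (px ∷ ps) e = cong₂ ℤ._+_ (e x px) (∑ℤ-congᴬ ps e)

*-distribˡ-∑ℤ : (c : ℤ) (xs : List A) (f : A → ℤ) → c ℤ.* ∑ℤ xs f ≡ ∑ℤ xs (λ x → c ℤ.* f x)
*-distribˡ-∑ℤ c []       f = ℤ.*-zeroʳ c
*-distribˡ-∑ℤ c (x ∷ xs) f =
  trans (ℤ.*-distribˡ-+ c (f x) _) (cong (ℤ._+_ (c ℤ.* f x)) (*-distribˡ-∑ℤ c xs f))

∑ℤ-pos : (xs : List A) (h : A → ℕ) → ∑ℤ xs (λ x → ℤ.+ h x) ≡ ℤ.+ ∑ xs h
∑ℤ-pos []       h = refl
∑ℤ-pos (x ∷ xs) h = trans (cong (ℤ._+_ (ℤ.+ h x)) (∑ℤ-pos xs h)) (sym (ℤ.pos-+ (h x) _))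

foldr-+-map-filterᵇ : (f : A → ℤ) (p : A → Bool) (xs : List A) →
  foldr ℤ._+_ ℤ.0ℤ (map f (filterᵇ p xs)) ≡ ∑ℤ xs (λ x → if p x then f x else ℤ.0ℤ)
foldr-+-map-filterᵇ f p []       = refl
foldr-+-map-filterᵇ f p (x ∷ xs) with p x
... | true  = cong (ℤ._+_ (f x)) (foldr-+-map-filterᵇ f p xs)
... | false = trans (foldr-+-map-filterᵇ f p xs) (sym (ℤ.+-identityˡ _))

∑<ℤ : ℕ → (ℕ → ℤ) → ℤ
∑<ℤ zero    f = ℤ.0ℤ
∑<ℤ (suc n) f = f 0 ℤ.+ ∑<ℤ n (f ∘ suc)

∏<ℤ : ℕ → (ℕ → ℤ) → ℤ
∏<ℤ zero    f = ℤ.1ℤ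
∏<ℤ (suc n) f = f 0 ℤ.* ∏<ℤ n (f ∘ suc)

∑<ℤ-cong : ∀ n {f g : ℕ → ℤ} → (∀ k → f k ≡ g k) → ∑<ℤ n f ≡ ∑<ℤ n g
∑<ℤ-cong zero    e = refl
∑<ℤ-cong (suc n) e = cong₂ ℤ._+_ (e 0) (∑<ℤ-cong n (e ∘ suc))

∏<ℤ-cong : ∀ n {f g : ℕ → ℤ} → (∀ k → f k ≡ g k) → ∏<ℤ n f ≡ ∏<ℤ n g
∏<ℤ-cong zero    e = refl
∏<ℤ-cong (suc n) e = cong₂ ℤ._*_ (e 0) (∏<ℤ-cong n (e ∘ suc))

∑<ℤ-suc : ∀ n f → ∑<ℤ (suc n) f ≡ ∑<ℤ n f ℤ.+ f n
∑<ℤ-suc zero    f = trans (ℤ.+-identityʳ (f 0)) (sym (ℤ.+-identityˡ (f 0)))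
∑<ℤ-suc (suc n) f = trans (cong (ℤ._+_ (f 0)) (∑<ℤ-suc n (f ∘ suc))) (sym (ℤ.+-assoc (f 0) _ _))

sumTo≡∑<ℤ : ∀ m f → sumTo m f ≡ ∑<ℤ (suc m) f
sumTo≡∑<ℤ zero    f = sym (ℤ.+-identityʳ (f 0))
sumTo≡∑<ℤ (suc m) f = trans (cong (ℤ._+ f (suc m)) (sumTo≡∑<ℤ m f)) (sym (∑<ℤ-suc (suc m) f))

∑<ℤ-*-pos : ∀ n c f → ∑<ℤ n (λ k → c ℤ.* ℤ.+ f k) ≡ c ℤ.* ℤ.+ ∑< n f
∑<ℤ-*-pos zero    c f = sym (ℤ.*-zeroʳ c)
∑<ℤ-*-pos (suc n) c f = begin
  c ℤ.* ℤ.+ f 0 ℤ.+ ∑<ℤ n (λ k → c ℤ.* ℤ.+ f (suc k)) ≡⟨ cong (ℤ._+_ (c ℤ.* ℤ.+ f 0)) (∑<ℤ-*-pos n c (f ∘ suc)) ⟩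
  c ℤ.* ℤ.+ f 0 ℤ.+ c ℤ.* ℤ.+ ∑< n (f ∘ suc)          ≡⟨ ℤ.*-distribˡ-+ c (ℤ.+ f 0) _ ⟨
  c ℤ.* (ℤ.+ f 0 ℤ.+ ℤ.+ ∑< n (f ∘ suc))              ≡⟨ cong (c ℤ.*_) (ℤ.pos-+ (f 0) _) ⟨
  c ℤ.* ℤ.+ ∑< (suc n) f                                ∎
  where open ≡-Reasoning

prodZ-applyUpTo : (g : ℕ → ℕ) (n : ℕ) (f : ℕ → ℤ) → prodZ (map f (applyUpTo g n)) ≡ ∏<ℤ n (f ∘ g)
prodZ-applyUpTo g zero    f = refl
prodZ-applyUpTo g (suc n) f = cong (f (g 0) ℤ.*_) (prodZ-applyUpTo (g ∘ suc) n f)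

signPow-+ : ∀ m n → signPow (m + n) ≡ signPow m ℤ.* signPow n
signPow-+ zero    n = sym (ℤ.*-identityˡ (signPow n))
signPow-+ (suc m) n = trans (cong ℤ.-_ (signPow-+ m n)) (ℤ.neg-distribˡ-* (signPow m) (signPow n))

signPow-square : ∀ m → signPow m ℤ.* signPow m ≡ ℤ.1ℤ
signPow-square zero    = refl
signPow-square (suc m) = begin
  ℤ.- signPow m ℤ.* ℤ.- signPow m       ≡⟨ ℤ.neg-distribˡ-* (signPow m) (ℤ.- signPow m) ⟨
  ℤ.- (signPow m ℤ.* ℤ.- signPow m)     ≡⟨ cong ℤ.-_ (ℤ.neg-distribʳ-* (signPow m) (signPow m)) ⟨
  ℤ.- ℤ.- (signPow m ℤ.* signPow m)     ≡⟨ ℤ.neg-involutive _ ⟩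
  signPow m ℤ.* signPow m               ≡⟨ signPow-square m ⟩
  ℤ.1ℤ                                   ∎
  where open ≡-Reasoning

∏<ℤ-signPow-* : ∀ n (β e : ℕ → ℕ) →
  ∏<ℤ n (λ k → signPow (β k) ℤ.* ℤ.+ e k) ≡ signPow (∑< n β) ℤ.* ℤ.+ ∏< n e
∏<ℤ-signPow-* zero    β e = refl
∏<ℤ-signPow-* (suc n) β e = begin
  signPow (β 0) ℤ.* ℤ.+ e 0 ℤ.* ∏<ℤ n (λ k → signPow (β (suc k)) ℤ.* ℤ.+ e (suc k))
    ≡⟨ cong (signPow (β 0) ℤ.* ℤ.+ e 0 ℤ.*_) (∏<ℤ-signPow-* n (β ∘ suc) (e ∘ suc)) ⟩
  signPow (β 0) ℤ.* ℤ.+ e 0 ℤ.* (signPow (∑< n (β ∘ suc)) ℤ.* ℤ.+ ∏< n (e ∘ suc))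
    ≡⟨ interchange ℤ.*-commutativeSemigroup (signPow (β 0)) (ℤ.+ e 0) _ _ ⟩
  signPow (β 0) ℤ.* signPow (∑< n (β ∘ suc)) ℤ.* (ℤ.+ e 0 ℤ.* ℤ.+ ∏< n (e ∘ suc))
    ≡⟨ cong₂ ℤ._*_ (signPow-+ (β 0) _) (ℤ.pos-* (e 0) _) ⟨
  signPow (∑< (suc n) β) ℤ.* ℤ.+ ∏< (suc n) e
    ∎
  where open ≡-Reasoning

signPow-cancel : ∀ s d x → signPow s ℤ.* (signPow d ℤ.* (signPow (s + d) ℤ.* x)) ≡ x
signPow-cancel s d x = begin
  σ ℤ.* (δ ℤ.* (signPow (s + d) ℤ.* x))  ≡⟨ cong (λ z → σ ℤ.* (δ ℤ.* (z ℤ.* x))) (signPow-+ s d) ⟩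
  σ ℤ.* (δ ℤ.* (σ ℤ.* δ ℤ.* x))          ≡⟨ ℤ.*-assoc σ δ _ ⟨
  σ ℤ.* δ ℤ.* (σ ℤ.* δ ℤ.* x)            ≡⟨ ℤ.*-assoc (σ ℤ.* δ) (σ ℤ.* δ) x ⟨
  σ ℤ.* δ ℤ.* (σ ℤ.* δ) ℤ.* x            ≡⟨ cong (ℤ._* x) (interchange ℤ.*-commutativeSemigroup σ δ σ δ) ⟩
  σ ℤ.* σ ℤ.* (δ ℤ.* δ) ℤ.* x            ≡⟨ cong (ℤ._* x) (cong₂ ℤ._*_ (signPow-square s) (signPow-square d)) ⟩
  ℤ.1ℤ ℤ.* x                              ≡⟨ ℤ.*-identityˡ x ⟩
  x                                       ∎
  where
  open ≡-Reasoning
  σ = signPow s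
  δ = signPow d

-- Bounded compositions and the powers of y(x) = -x/(1 - x)

-- The number of (x₁ , … , x_β) ∈ {1 … B}^β with u + x₁ + ⋯ + x_β = t.
compositions : (B β u t : ℕ) → ℕ
compositions B zero    u t = ⟦ u ≡ᵇ t ⟧
compositions B (suc β) u t = ∑ (applyUpTo suc B) (λ x → compositions B β (x + u) t)

compositions-suc : ∀ B β u t → compositions B (suc β) u t ≡ ∑< B (λ k → compositions B β (suc k + u) t)
compositions-suc B β u t = ∑-applyUpTo suc B (λ x → compositions B β (x + u) t)

≡ᵇ-+-cancelʳ : ∀ d m n → (m + d ≡ᵇ n + d) ≡ (m ≡ᵇ n)
≡ᵇ-+-cancelʳ d m n rewrite +-comm m d | +-comm n d = cancelˡ d
  where
  cancelˡ : ∀ d → (d + m ≡ᵇ d + n) ≡ (m ≡ᵇ n)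
  cancelˡ zero    = refl
  cancelˡ (suc d) = cancelˡ d

>⇒≡ᵇ-false : ∀ m n → n < m → (m ≡ᵇ n) ≡ false
>⇒≡ᵇ-false (suc m) zero    _         = refl
>⇒≡ᵇ-false (suc m) (suc n) (s≤s n<m) = >⇒≡ᵇ-false m n n<m

compositions-shift : ∀ B β u t d → compositions B β (u + d) (t + d) ≡ compositions B β u t
compositions-shift B zero    u t d = cong ⟦_⟧ (≡ᵇ-+-cancelʳ d u t)
compositions-shift B (suc β) u t d = ∑-cong (applyUpTo suc B) λ x →
  trans (cong (λ m → compositions B β m (t + d)) (sym (+-assoc x u d))) (compositions-shift B β (x + u) t d)

compositions-overshoot : ∀ B β u t → t < u → compositions B β u t ≡ 0
compositions-overshoot B zero    u t t<u = cong ⟦_⟧ (>⇒≡ᵇ-false u t t<u)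
compositions-overshoot B (suc β) u t t<u = ∑-zero (applyUpTo suc B) λ x →
  compositions-overshoot B β (x + u) t (≤-trans t<u (m≤n+m u x))

-- Splitting off the first part x = k + 1: only k ≤ t contributes, and the bound B is
-- not felt as long as t < B.
compositions-first-part : ∀ B β t → suc t ≤ B →
  compositions B (suc β) 0 (suc t) ≡ ∑< (suc t) (λ k → compositions B β 0 (t ∸ k))
compositions-first-part B β t t<B = begin
  compositions B (suc β) 0 (suc t)                         ≡⟨ compositions-suc B β 0 (suc t) ⟩
  ∑< B f                                                   ≡⟨ cong (λ m → ∑< m f) (m+[n∸m]≡n t<B) ⟨
  ∑< (suc t + (B ∸ suc t)) f                               ≡⟨ ∑<-+ (suc t) (B ∸ suc t) f ⟩
  ∑< (suc t) f + ∑< (B ∸ suc t) (λ k → f (suc t + k))      ≡⟨ cong₂ _+_ (∑<-cong (suc t) first) (∑<-zero (B ∸ suc t) overshoot) ⟩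
  ∑< (suc t) (λ k → compositions B β 0 (t ∸ k)) + 0        ≡⟨ +-identityʳ _ ⟩
  ∑< (suc t) (λ k → compositions B β 0 (t ∸ k))            ∎
  where
  open ≡-Reasoning
  f : ℕ → ℕ
  f k = compositions B β (suc k + 0) (suc t)
  first : ∀ k → k < suc t → f k ≡ compositions B β 0 (t ∸ k)
  first k (s≤s k≤t) = trans (cong₂ (compositions B β) (+-identityʳ (suc k)) t+1≡[t∸k]+[k+1])
                            (compositions-shift B β 0 (t ∸ k) (suc k))
    where
    t+1≡[t∸k]+[k+1] : suc t ≡ (t ∸ k) + suc k
    t+1≡[t∸k]+[k+1] = trans (cong suc (sym (m∸n+n≡m k≤t))) (sym (+-suc (t ∸ k) k))
  overshoot : ∀ k → f (suc t + k) ≡ 0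
  overshoot k = compositions-overshoot B β _ _ (s≤s (s≤s (≤-trans (m≤m+n t k) (≤-reflexive (sym (+-identityʳ (t + k)))))))

ySeries^-coefficient : ∀ B β t → t ≤ B → (ySeries ^ˢ β) t ≡ signPow β ℤ.* ℤ.+ compositions B β 0 t
ySeries^-coefficient B zero    zero    _   = refl
ySeries^-coefficient B zero    (suc t) _   = refl
ySeries^-coefficient B (suc β) zero    _   = sym (trans
  (cong (λ m → signPow (suc β) ℤ.* ℤ.+ m)
        (trans (compositions-suc B β 0 0) (∑<-zero B (λ k → compositions-overshoot B β (suc k + 0) 0 (s≤s z≤n)))))
  (ℤ.*-zeroʳ (signPow (suc β))))
ySeries^-coefficient B (suc β) (suc t) t<B = begin
  sumTo (suc t) (λ k → ySeries k ℤ.* (ySeries ^ˢ β) (suc t ∸ k))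
    ≡⟨ sumTo≡∑<ℤ (suc t) _ ⟩
  ℤ.0ℤ ℤ.+ ∑<ℤ (suc t) (λ k → ℤ.-1ℤ ℤ.* (ySeries ^ˢ β) (t ∸ k))
    ≡⟨ ℤ.+-identityˡ _ ⟩
  ∑<ℤ (suc t) (λ k → ℤ.-1ℤ ℤ.* (ySeries ^ˢ β) (t ∸ k))
    ≡⟨ ∑<ℤ-cong (suc t) (λ k → trans (cong (ℤ.-1ℤ ℤ.*_) (ySeries^-coefficient B β (t ∸ k) (t∸k≤B k)))
                                      (sym (ℤ.*-assoc ℤ.-1ℤ (signPow β) _))) ⟩
  ∑<ℤ (suc t) (λ k → ℤ.-1ℤ ℤ.* signPow β ℤ.* ℤ.+ compositions B β 0 (t ∸ k))
    ≡⟨ ∑<ℤ-*-pos (suc t) (ℤ.-1ℤ ℤ.* signPow β) (λ k → compositions B β 0 (t ∸ k)) ⟩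
  ℤ.-1ℤ ℤ.* signPow β ℤ.* ℤ.+ ∑< (suc t) (λ k → compositions B β 0 (t ∸ k))
    ≡⟨ cong₂ (λ σ m → σ ℤ.* ℤ.+ m) (sym (ℤ.-1*i≡-i (signPow β))) (compositions-first-part B β t t<B) ⟨
  signPow (suc β) ℤ.* ℤ.+ compositions B (suc β) 0 (suc t)
    ∎
  where
  open ≡-Reasoning
  t∸k≤B : ∀ k → t ∸ k ≤ B
  t∸k≤B k = ≤-trans (m∸n≤m t k) (≤-trans (n≤1+n t) t<B)

-- The support of a multiplicity list c is map (_⊓ 1) c; lifts s bs lists the
-- multiplicity lists bounded by bs with support s, built from the choices for one letter.
liftsOfBit : ℕ → ℕ → List ℕ
liftsOfBit zero    B = 0 ∷ []
liftsOfBit (suc _) B = applyUpTo suc B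

lifts : Content → List ℕ → List Content
lifts s []       = [] ∷ []
lifts s (b ∷ bs) = concatMap (λ x → map (x ∷_) (lifts (drop 1 s) bs)) (liftsOfBit (mult s 0) b)

mult-drop1 : ∀ s p → mult s (suc p) ≡ mult (drop 1 s) p
mult-drop1 []      p = refl
mult-drop1 (_ ∷ _) p = refl

∑-lifts-∷ : (s : Content) (b : ℕ) (bs : List ℕ) (φ : Content → ℕ) →
  ∑ (lifts s (b ∷ bs)) φ ≡ ∑ (liftsOfBit (mult s 0) b) (λ x → ∑ (lifts (drop 1 s) bs) (φ ∘ (x ∷_)))
∑-lifts-∷ s b bs φ = trans (∑-concatMap (λ x → map (x ∷_) (lifts (drop 1 s) bs)) (liftsOfBit (mult s 0) b) φ)
  (∑-cong (liftsOfBit (mult s 0) b) (λ x → ∑-map (x ∷_) (lifts (drop 1 s) bs) φ))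

∑-boundedLists-∷ : (b : ℕ) (bs : List ℕ) (φ : Content → ℕ) →
  ∑ (boundedLists (b ∷ bs)) φ ≡ ∑ (upTo (suc b)) (λ x → ∑ (boundedLists bs) (φ ∘ (x ∷_)))
∑-boundedLists-∷ b bs φ = trans (∑-concatMap (λ x → map (x ∷_) (boundedLists bs)) (upTo (suc b)) φ)
  (∑-cong (upTo (suc b)) (λ x → ∑-map (x ∷_) (boundedLists bs) φ))

∑-upTo-by-bit : ∀ b (ψ : ℕ → ℕ) → ∑ (upTo (suc b)) ψ ≡ ∑ (upTo (suc (b ⊓ 1))) (λ m → ∑ (liftsOfBit m b) ψ)
∑-upTo-by-bit zero    ψ = cong (_+ 0) (sym (+-identityʳ (ψ 0)))
∑-upTo-by-bit (suc b) ψ rewrite ⊓-zeroʳ b = cong₂ _+_ (sym (+-identityʳ (ψ 0))) (sym (+-identityʳ _))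

∑-boundedLists-by-support : ∀ bs (φ : Content → ℕ) →
  ∑ (boundedLists bs) φ ≡ ∑ (boundedLists (map (_⊓ 1) bs)) (λ s → ∑ (lifts s bs) φ)
∑-boundedLists-by-support []       φ = cong (_+ 0) (sym (+-identityʳ (φ [])))
∑-boundedLists-by-support (b ∷ bs) φ = begin
  ∑ (boundedLists (b ∷ bs)) φ
    ≡⟨ ∑-boundedLists-∷ b bs φ ⟩
  ∑ (upTo (suc b)) (λ x → ∑ (boundedLists bs) (φ ∘ (x ∷_)))
    ≡⟨ ∑-cong (upTo (suc b)) (λ x → ∑-boundedLists-by-support bs (φ ∘ (x ∷_))) ⟩
  ∑ (upTo (suc b)) (λ x → ∑ S (λ s → ψ x s))
    ≡⟨ ∑-upTo-by-bit b _ ⟩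
  ∑ (upTo (suc (b ⊓ 1))) (λ m → ∑ (liftsOfBit m b) (λ x → ∑ S (λ s → ψ x s)))
    ≡⟨ ∑-cong (upTo (suc (b ⊓ 1))) (λ m → ∑-comm (liftsOfBit m b) S ψ) ⟩
  ∑ (upTo (suc (b ⊓ 1))) (λ m → ∑ S (λ s → ∑ (liftsOfBit m b) (λ x → ψ x s)))
    ≡⟨ ∑-cong (upTo (suc (b ⊓ 1))) (λ m → ∑-cong S (λ s → ∑-lifts-∷ (m ∷ s) b bs φ)) ⟨
  ∑ (upTo (suc (b ⊓ 1))) (λ m → ∑ S (λ s → ∑ (lifts (m ∷ s) (b ∷ bs)) φ))
    ≡⟨ ∑-boundedLists-∷ (b ⊓ 1) (map (_⊓ 1) bs) (λ s → ∑ (lifts s (b ∷ bs)) φ) ⟨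
  ∑ (boundedLists (map (_⊓ 1) (b ∷ bs))) (λ s → ∑ (lifts s (b ∷ bs)) φ)
    ∎
  where
  open ≡-Reasoning
  S = boundedLists (map (_⊓ 1) bs)
  ψ : ℕ → Content → ℕ
  ψ x s = ∑ (lifts s bs) (φ ∘ (x ∷_))

liftSum : List ℕ → Filling → (Filling → ℕ) → ℕ
liftSum bs []            g = g []
liftSum bs ((b , s) ∷ S) g = ∑ (lifts s bs) (λ c → liftSum bs S (g ∘ ((b , c) ∷_)))

liftSum-cong : ∀ bs S {g g′ : Filling → ℕ} → (∀ F → g F ≡ g′ F) → liftSum bs S g ≡ liftSum bs S g′
liftSum-cong bs []            e = e []
liftSum-cong bs ((b , s) ∷ S) e = ∑-cong (lifts s bs) (λ c → liftSum-cong bs S (e ∘ ((b , c) ∷_)))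

liftSum-*ˡ : ∀ bs S (c : ℕ) (g : Filling → ℕ) → liftSum bs S (λ F → c * g F) ≡ c * liftSum bs S g
liftSum-*ˡ bs []            c g = refl
liftSum-*ˡ bs ((b , s) ∷ S) c g =
  trans (∑-cong (lifts s bs) (λ c′ → liftSum-*ˡ bs S c (g ∘ ((b , c′) ∷_))))
        (sym (*-distribˡ-∑ c (lifts s bs) _))

∑-fillings-∷ : (b : Box) (bl : List Box) (cs : List Content) (g : Filling → ℕ) →
  ∑ (fillings (b ∷ bl) cs) g ≡ ∑ cs (λ c → ∑ (fillings bl cs) (g ∘ ((b , c) ∷_)))
∑-fillings-∷ b bl cs g = trans (∑-concatMap (λ c → map ((b , c) ∷_) (fillings bl cs)) cs g)
  (∑-cong cs (λ c → ∑-map ((b , c) ∷_) (fillings bl cs) g))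

∑-fillings-by-support : ∀ (bl : List Box) bs (g : Filling → ℕ) →
  ∑ (fillings bl (boundedLists bs)) g ≡ ∑ (fillings bl (boundedLists (map (_⊓ 1) bs))) (λ S → liftSum bs S g)
∑-fillings-by-support []       bs g = refl
∑-fillings-by-support (b ∷ bl) bs g = begin
  ∑ (fillings (b ∷ bl) C) g
    ≡⟨ ∑-fillings-∷ b bl C g ⟩
  ∑ C (λ c → ∑ (fillings bl C) (g ∘ ((b , c) ∷_)))
    ≡⟨ ∑-cong C (λ c → ∑-fillings-by-support bl bs (g ∘ ((b , c) ∷_))) ⟩
  ∑ C (λ c → ∑ (fillings bl S) (λ T → liftSum bs T (g ∘ ((b , c) ∷_))))
    ≡⟨ ∑-boundedLists-by-support bs _ ⟩
  ∑ S (λ s → ∑ (lifts s bs) (λ c → ∑ (fillings bl S) (λ T → liftSum bs T (g ∘ ((b , c) ∷_)))))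
    ≡⟨ ∑-cong S (λ s → ∑-comm (lifts s bs) (fillings bl S) _) ⟩
  ∑ S (λ s → ∑ (fillings bl S) (λ T → liftSum bs ((b , s) ∷ T) g))
    ≡⟨ ∑-fillings-∷ b bl S _ ⟨
  ∑ (fillings (b ∷ bl) S) (λ T → liftSum bs T g)
    ∎
  where
  open ≡-Reasoning
  C = boundedLists bs
  S = boundedLists (map (_⊓ 1) bs)

letterCount : ℕ → Content → ℕ
letterCount k c = mult c (2 * k) + mult c (suc (2 * k))

letterCount-∷∷ : ∀ x₀ x₁ c k → letterCount (suc k) (x₀ ∷ x₁ ∷ c) ≡ letterCount k c
letterCount-∷∷ x₀ x₁ c k = cong (λ m → mult (x₀ ∷ x₁ ∷ c) m + mult (x₀ ∷ x₁ ∷ c) (suc m)) (*-suc 2 k)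

IsSetContent : Content → Set
IsSetContent c = ∀ p → mult c p ≤ 1

pairLiftSum : Content → List ℕ → (ℕ → ℕ → ℕ) → ℕ → ℕ
pairLiftSum s a h k = ∑ (liftsOfBit (mult s (2 * k)) (mult a k)) λ x₀ →
                      ∑ (liftsOfBit (mult s (suc (2 * k))) (mult a k)) λ x₁ → h k (x₀ + x₁)

pairLiftSum-suc : ∀ s a₀ a h k →
  pairLiftSum s (a₀ ∷ a) h (suc k) ≡ pairLiftSum (drop 1 (drop 1 s)) a (h ∘ suc) k
pairLiftSum-suc s a₀ a h k
  rewrite *-suc 2 k | mult-drop1 s (suc (2 * k)) | mult-drop1 (drop 1 s) (2 * k)
        | mult-drop1 s (suc (suc (2 * k))) | mult-drop1 (drop 1 s) (suc (2 * k)) = refl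

-- The lifts of a box content are chosen letter by letter, so a product over letters
-- can be summed factor by factor.
∑-lifts-∏< : ∀ a s (h : ℕ → ℕ → ℕ) →
  ∑ (lifts s (weakBounds a)) (λ c → ∏< (length a) (λ k → h k (letterCount k c))) ≡ ∏< (length a) (pairLiftSum s a h)
∑-lifts-∏< []       s h = refl
∑-lifts-∏< (a₀ ∷ a) s h = begin
  ∑ (lifts s (weakBounds (a₀ ∷ a))) (λ c → ∏< (suc n) (λ k → h k (letterCount k c)))
    ≡⟨ ∑-lifts-∷ s a₀ (a₀ ∷ weakBounds a) _ ⟩
  ∑ X₀ (λ x₀ → ∑ (lifts (drop 1 s) (a₀ ∷ weakBounds a)) (λ c → ∏< (suc n) (λ k → h k (letterCount k (x₀ ∷ c)))))
    ≡⟨ ∑-cong X₀ (λ x₀ → ∑-lifts-∷ (drop 1 s) a₀ (weakBounds a) _) ⟩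
  ∑ X₀ (λ x₀ → ∑ X₁ (λ x₁ → ∑ L (λ c → h 0 (x₀ + x₁) * ∏< n (λ k → h (suc k) (letterCount (suc k) (x₀ ∷ x₁ ∷ c))))))
    ≡⟨ ∑-cong X₀ (λ x₀ → ∑-cong X₁ (λ x₁ → ∑-cong L (λ c → cong (h 0 (x₀ + x₁) *_)
         (∏<-cong n (λ k → cong (h (suc k)) (letterCount-∷∷ x₀ x₁ c k)))))) ⟩
  ∑ X₀ (λ x₀ → ∑ X₁ (λ x₁ → ∑ L (λ c → h 0 (x₀ + x₁) * P c)))
    ≡⟨ ∑-cong X₀ (λ x₀ → ∑-cong X₁ (λ x₁ → *-distribˡ-∑ (h 0 (x₀ + x₁)) L P)) ⟨
  ∑ X₀ (λ x₀ → ∑ X₁ (λ x₁ → h 0 (x₀ + x₁) * ∑ L P))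
    ≡⟨ ∑-cong X₀ (λ x₀ → *-distribʳ-∑ (∑ L P) X₁ _) ⟨
  ∑ X₀ (λ x₀ → ∑ X₁ (λ x₁ → h 0 (x₀ + x₁)) * ∑ L P)
    ≡⟨ *-distribʳ-∑ (∑ L P) X₀ _ ⟨
  ∑ X₀ (λ x₀ → ∑ X₁ (λ x₁ → h 0 (x₀ + x₁))) * ∑ L P
    ≡⟨ cong₂ _*_ (cong (λ m → ∑ X₀ (λ x₀ → ∑ (liftsOfBit m a₀) (λ x₁ → h 0 (x₀ + x₁)))) (sym (mult-drop1 s 0)))
                 (∑-lifts-∏< a (drop 1 (drop 1 s)) (h ∘ suc)) ⟩
  pairLiftSum s (a₀ ∷ a) h 0 * ∏< n (pairLiftSum (drop 1 (drop 1 s)) a (h ∘ suc))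
    ≡⟨ cong (pairLiftSum s (a₀ ∷ a) h 0 *_) (∏<-cong n (pairLiftSum-suc s a₀ a h)) ⟨
  ∏< (suc n) (pairLiftSum s (a₀ ∷ a) h)
    ∎
  where
  open ≡-Reasoning
  n  = length a
  X₀ = liftsOfBit (mult s 0) a₀
  X₁ = liftsOfBit (mult (drop 1 s) 0) a₀
  L  = lifts (drop 1 (drop 1 s)) (weakBounds a)
  P : Content → ℕ
  P c = ∏< n (λ k → h (suc k) (letterCount k c))

∑-liftsOfBit-compositions : ∀ B m β u t → m ≤ 1 →
  ∑ (liftsOfBit m B) (λ x → compositions B β (x + u) t) ≡ compositions B (m + β) u t
∑-liftsOfBit-compositions B zero          β u t _ = +-identityʳ _
∑-liftsOfBit-compositions B (suc zero)    β u t _ = refl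
∑-liftsOfBit-compositions B (suc (suc m)) β u t (s≤s ())

pairLiftSum-compositions : ∀ a s (β u : ℕ → ℕ) k → IsSetContent s →
  pairLiftSum s a (λ k′ x → compositions (mult a k′) (β k′) (x + u k′) (mult a k′)) k
    ≡ compositions (mult a k) (letterCount k s + β k) (u k) (mult a k)
pairLiftSum-compositions a s β u k set = begin
  ∑ (liftsOfBit m₀ aₖ) (λ x₀ → ∑ (liftsOfBit m₁ aₖ) (λ x₁ → compositions aₖ (β k) (x₀ + x₁ + u k) aₖ))
    ≡⟨ ∑-cong (liftsOfBit m₀ aₖ) (λ x₀ → ∑-cong (liftsOfBit m₁ aₖ) (λ x₁ →
         cong (λ v → compositions aₖ (β k) v aₖ) (xy∙z≈y∙xz +-commutativeSemigroup x₀ x₁ (u k)))) ⟩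
  ∑ (liftsOfBit m₀ aₖ) (λ x₀ → ∑ (liftsOfBit m₁ aₖ) (λ x₁ → compositions aₖ (β k) (x₁ + (x₀ + u k)) aₖ))
    ≡⟨ ∑-cong (liftsOfBit m₀ aₖ) (λ x₀ → ∑-liftsOfBit-compositions aₖ m₁ (β k) (x₀ + u k) aₖ (set (suc (2 * k)))) ⟩
  ∑ (liftsOfBit m₀ aₖ) (λ x₀ → compositions aₖ (m₁ + β k) (x₀ + u k) aₖ)
    ≡⟨ ∑-liftsOfBit-compositions aₖ m₀ (m₁ + β k) (u k) aₖ (set (2 * k)) ⟩
  compositions aₖ (m₀ + (m₁ + β k)) (u k) aₖ
    ≡⟨ cong (λ γ → compositions aₖ γ (u k) aₖ) (+-assoc m₀ m₁ (β k)) ⟨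
  compositions aₖ (letterCount k s + β k) (u k) aₖ
    ∎
  where
  open ≡-Reasoning
  aₖ = mult a k
  m₀ = mult s (2 * k)
  m₁ = mult s (suc (2 * k))

-- u k is the weight of letter k accumulated from the boxes already lifted.
liftSum-weight : ∀ a S (u : ℕ → ℕ) → All (IsSetContent ∘ proj₂) S →
  liftSum (weakBounds a) S (λ F → ∏< (length a) (λ k → ⟦ wt F k + u k ≡ᵇ mult a k ⟧))
    ≡ ∏< (length a) (λ k → compositions (mult a k) (wt S k) (u k) (mult a k))
liftSum-weight a []            u []           = refl
liftSum-weight a ((b , s) ∷ S) u (set ∷ sets) = begin
  ∑ (lifts s wb) (λ c → liftSum wb S (λ F → ∏< n (λ k → ⟦ letterCount k c + wt F k + u k ≡ᵇ mult a k ⟧)))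
    ≡⟨ ∑-cong (lifts s wb) (λ c → liftSum-cong wb S (λ F → ∏<-cong n (λ k →
         cong (λ m → ⟦ m ≡ᵇ mult a k ⟧) (xy∙z≈y∙xz +-commutativeSemigroup (letterCount k c) (wt F k) (u k))))) ⟩
  ∑ (lifts s wb) (λ c → liftSum wb S (λ F → ∏< n (λ k → ⟦ wt F k + (letterCount k c + u k) ≡ᵇ mult a k ⟧)))
    ≡⟨ ∑-cong (lifts s wb) (λ c → liftSum-weight a S (λ k → letterCount k c + u k) sets) ⟩
  ∑ (lifts s wb) (λ c → ∏< n (λ k → compositions (mult a k) (wt S k) (letterCount k c + u k) (mult a k)))
    ≡⟨ ∑-lifts-∏< a s (λ k x → compositions (mult a k) (wt S k) (x + u k) (mult a k)) ⟩
  ∏< n (pairLiftSum s a (λ k x → compositions (mult a k) (wt S k) (x + u k) (mult a k)))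
    ≡⟨ ∏<-cong n (λ k → pairLiftSum-compositions a s (wt S) u k set) ⟩
  ∏< n (λ k → compositions (mult a k) (letterCount k s + wt S k) (u k) (mult a k))
    ∎
  where
  open ≡-Reasoning
  n  = length a
  wb = weakBounds a

data Fills (Q : Content → Set) : List Box → Filling → Set where
  []  : Fills Q [] []
  _∷_ : ∀ {b c bs F} → Q c → Fills Q bs F → Fills Q (b ∷ bs) ((b , c) ∷ F)

All-concatMap⁺ : {P : A → Set} {Q : B → Set} (f : A → List B) {xs : List A} →
  (∀ {x} → P x → All Q (f x)) → All P xs → All Q (concatMap f xs)
All-concatMap⁺ f h ps = All.concat⁺ (All.map⁺ (All.map h ps))

fillings-Fills : ∀ {Q : Content → Set} bs cs → All Q cs → All (Fills Q bs) (fillings bs cs)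
fillings-Fills []       cs qs = [] ∷ []
fillings-Fills (b ∷ bs) cs qs = All-concatMap⁺ (λ c → map ((b , c) ∷_) (fillings bs cs))
  (λ qc → All.map⁺ (All.map (qc ∷_) (fillings-Fills bs cs qs))) qs

Fills-length : ∀ {Q bs S} → Fills Q bs S → length S ≡ length bs
Fills-length []      = refl
Fills-length (_ ∷ f) = cong suc (Fills-length f)

Fills-contents : ∀ {Q bs S} → Fills Q bs S → All (Q ∘ proj₂) S
Fills-contents []      = []
Fills-contents (q ∷ f) = q ∷ Fills-contents f

boundedLists-bounded : ∀ bs → All (λ c → Pointwise _≤_ c bs) (boundedLists bs)
boundedLists-bounded []       = [] ∷ []
boundedLists-bounded (b ∷ bs) = All-concatMap⁺ (λ x → map (x ∷_) (boundedLists bs))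
  (λ x≤b → All.map⁺ (All.map (x≤b ∷_) (boundedLists-bounded bs)))
  (All.applyUpTo⁺₁ id (suc b) ≤-pred)

length-weakBounds : ∀ a → length (weakBounds a) ≡ 2 * length a
length-weakBounds []      = refl
length-weakBounds (x ∷ a) = trans (cong (suc ∘ suc) (length-weakBounds a)) (sym (*-suc 2 (length a)))

IsSetContentOf : ℕ → Content → Set
IsSetContentOf n c = length c ≡ 2 * n × IsSetContent c

bounded-by-≤1 : ∀ {c bs} → Pointwise _≤_ c bs → All (_≤ 1) bs → IsSetContent c
bounded-by-≤1 []           []           p       = z≤n
bounded-by-≤1 (x≤b ∷ _)    (b≤1 ∷ _)    zero    = ≤-trans x≤b b≤1
bounded-by-≤1 (_ ∷ c≤bs)   (_ ∷ bs≤1)   (suc p) = bounded-by-≤1 c≤bs bs≤1 p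

setBoundedLists-sets : ∀ a → All (IsSetContentOf (length a)) (boundedLists (setBounds a))
setBoundedLists-sets a = All.map
  (λ c≤bs → trans (Pointwise-length c≤bs) (trans (List.length-map (_⊓ 1) (weakBounds a)) (length-weakBounds a))
          , bounded-by-≤1 c≤bs (All.map⁺ (All.universal (λ b → m⊓n≤n b 1) (weakBounds a))))
  (boundedLists-bounded (setBounds a))

-- The tableau conditions only depend on supports

SameSupport : ℕ → Content → Content → Set
SameSupport n c s = ∀ p → p < 2 * n → occurs c p ≡ occurs s p

Over : ℕ → Box × Content → Box × Content → Set
Over n (b , s) (b′ , c) = b ≡ b′ × SameSupport n c s

liftsOfBit-occurs : ∀ m B → All (λ x → (0 <ᵇ x) ≡ (0 <ᵇ m)) (liftsOfBit m B)
liftsOfBit-occurs zero    B = refl ∷ []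
liftsOfBit-occurs (suc m) B = All.applyUpTo⁺₂ suc B (λ _ → refl)

lifts-support : ∀ s bs → All (λ c → ∀ p → p < length bs → occurs c p ≡ occurs s p) (lifts s bs)
lifts-support s []       = (λ p ()) ∷ []
lifts-support s (b ∷ bs) = All-concatMap⁺ (λ x → map (x ∷_) (lifts (drop 1 s) bs))
  (λ {x} occ → All.map⁺ (All.map (λ occs → λ where
      zero    _         → occ
      (suc p) (s≤s p<)  → trans (occs p p<) (cong (0 <ᵇ_) (sym (mult-drop1 s p))))
    (lifts-support (drop 1 s) bs)))
  (liftsOfBit-occurs (mult s 0) b)

liftSum-congᴼ : ∀ n bs S {g g′ : Filling → ℕ} → length bs ≡ 2 * n →
  (∀ F → Pointwise (Over n) S F → g F ≡ g′ F) → liftSum bs S g ≡ liftSum bs S g′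
liftSum-congᴼ n bs []            _  e = e [] []
liftSum-congᴼ n bs ((b , s) ∷ S) ∣bs∣ e = ∑-congᴬ (lifts-support s bs) λ c same →
  liftSum-congᴼ n bs S ∣bs∣ (λ F over → e ((b , c) ∷ F) ((refl , λ p p< → same p (subst (p <_) (sym ∣bs∣) p<)) ∷ over))

all-congᴬ : {P : A → Set} {xs : List A} {p q : A → Bool} →
  All P xs → (∀ x → P x → p x ≡ q x) → all p xs ≡ all q xs
all-congᴬ []                 e = refl
all-congᴬ {xs = x ∷ _} (px ∷ ps) e = cong₂ _∧_ (e x px) (all-congᴬ ps e)

any-congᴬ : {P : A → Set} {xs : List A} {p q : A → Bool} →
  All P xs → (∀ x → P x → p x ≡ q x) → any p xs ≡ any q xs
any-congᴬ []                 e = refl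
any-congᴬ {xs = x ∷ _} (px ∷ ps) e = cong₂ _∨_ (e x px) (any-congᴬ ps e)

all-Pointwise : {R : A → A → Set} {xs ys : List A} {p q : A → Bool} →
  Pointwise R xs ys → (∀ x y → R x y → p y ≡ q x) → all p ys ≡ all q xs
all-Pointwise []                       e = refl
all-Pointwise {xs = x ∷ _} {y ∷ _} (r ∷ rs) e = cong₂ _∧_ (e x y r) (all-Pointwise rs e)

module _ (n : ℕ) where
  private
    inLetters : ∀ {c s} → SameSupport n c s → (f : Bool → ℕ → Bool) →
                all (λ p → f (occurs c p) p) (letters n) ≡ all (λ p → f (occurs s p) p) (letters n)
    inLetters same f = all-congᴬ (All.all-upTo (2 * n)) (λ p p< → cong (λ o → f o p) (same p p<))

    inLetters₂ : ∀ {c s d t} → SameSupport n c s → SameSupport n d t → (f : Bool → Bool → ℕ → Bool) →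
                 all (λ p → f (occurs c p) (occurs d p) p) (letters n) ≡ all (λ p → f (occurs s p) (occurs t p) p) (letters n)
    inLetters₂ same same′ f = all-congᴬ (All.all-upTo (2 * n)) (λ p p< → cong₂ (λ o o′ → f o o′ p) (same p p<) (same′ p p<))

    leqAll-support : ∀ {c s d t} → SameSupport n c s → SameSupport n d t → leqAll n c d ≡ leqAll n s t
    leqAll-support same same′ = all-congᴬ (All.all-upTo (2 * n)) λ p p< → all-congᴬ (All.all-upTo (2 * n)) λ q q< →
      cong₂ (λ o o′ → not (o ∧ o′) ∨ (p ≤ᵇ q)) (same p p<) (same′ q q<)

  isWeakSVST-support : ∀ {S F} → Pointwise (Over n) S F → isWeakSVST n F ≡ isWeakSVST n S
  isWeakSVST-support over = cong₂ _∧_ nonempty-inv (cong₂ _∧_ rowColOrder-inv (cong₂ _∧_ noPrimedDiag-inv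
                              (cong₂ _∧_ colUnprimed-inv rowPrimed-inv)))
    where
    nonempty-inv = all-Pointwise over λ { (_ , s) (_ , c) (_ , same) →
      any-congᴬ (All.all-upTo (2 * n)) (λ p p< → same p p<) }
    rowColOrder-inv = all-Pointwise over λ { (_ , s) (_ , c) (refl , same) → all-Pointwise over λ { (_ , t) (_ , d) (refl , same′) →
      cong (_ ∨_) (leqAll-support {c} {s} {d} {t} same same′) } }
    noPrimedDiag-inv = all-Pointwise over λ { (_ , s) (_ , c) (refl , same) →
      cong (_ ∨_) (inLetters {c} {s} same (λ o p → not (isPrimed p ∧ o))) }
    colUnprimed-inv = all-Pointwise over λ { (_ , s) (_ , c) (refl , same) → all-Pointwise over λ { (_ , t) (_ , d) (refl , same′) →
      cong (_ ∨_) (inLetters₂ {c} {s} {d} {t} same same′ (λ o o′ p → not (not (isPrimed p) ∧ o ∧ o′))) } }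
    rowPrimed-inv = all-Pointwise over λ { (_ , s) (_ , c) (refl , same) → all-Pointwise over λ { (_ , t) (_ , d) (refl , same′) →
      cong (_ ∨_) (inLetters₂ {c} {s} {d} {t} same same′ (λ o o′ p → not (isPrimed p ∧ o ∧ o′))) } }

mult≤sum : ∀ c p → mult c p ≤ sum c
mult≤sum []      p       = z≤n
mult≤sum (x ∷ c) zero    = m≤m+n x (sum c)
mult≤sum (x ∷ c) (suc p) = ≤-trans (mult≤sum c p) (m≤n+m (sum c) x)

nonempty⇒1≤sum : ∀ n c → T (nonempty n c) → 1 ≤ sum c
nonempty⇒1≤sum n c ne with satisfied (Any.any⁻ (occurs c) (letters n) ne)
... | p , occ = ≤-trans (<ᵇ⇒< 0 (mult c p) occ) (mult≤sum c p)

length≤total : ∀ n S → T (all (nonempty n ∘ proj₂) S) → length S ≤ total S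
length≤total n []            _  = z≤n
length≤total n ((b , c) ∷ S) ne = let neᶜ , neˢ = Equivalence.to T-∧ ne in
  +-mono-≤ (nonempty⇒1≤sum n c neᶜ) (length≤total n S neˢ)

∑<-letterCount : ∀ n c → length c ≡ 2 * n → ∑< n (λ k → letterCount k c) ≡ sum c
∑<-letterCount zero    []      _ = refl
∑<-letterCount (suc n) (x₀ ∷ x₁ ∷ c) ∣c∣ = trans
  (cong (x₀ + x₁ +_) (trans (∑<-cong n (λ k _ → letterCount-∷∷ x₀ x₁ c k))
                            (∑<-letterCount n c (suc-injective (suc-injective ∣c∣′)))))
  (+-assoc x₀ x₁ (sum c))
  where
  ∣c∣′ : suc (suc (length c)) ≡ suc (suc (2 * n))
  ∣c∣′ = trans ∣c∣ (*-suc 2 n)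
∑<-letterCount zero    (_ ∷ _) ()
∑<-letterCount (suc n) []      ∣c∣ with () ← trans ∣c∣ (*-suc 2 n)
∑<-letterCount (suc n) (_ ∷ []) ∣c∣ with () ← trans ∣c∣ (*-suc 2 n)

∑<-wt : ∀ n S → All (λ e → length (proj₂ e) ≡ 2 * n) S → ∑< n (wt S) ≡ total S
∑<-wt n []            []       = ∑<-zero n (λ _ → refl)
∑<-wt n ((b , c) ∷ S) (l ∷ ls) =
  trans (∑<-distrib-+ n (λ k → letterCount k c) (wt S)) (cong₂ _+_ (∑<-letterCount n c l) (∑<-wt n S ls))

-- Both coefficients as sums over set-valued fillings

-- the number of lifts of S of weight a
liftCount : List ℕ → Filling → ℕ
liftCount a S = ∏< (length a) (λ k → compositions (mult a k) (wt S k) 0 (mult a k))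

SetFillingOf : List ℕ → List ℕ → Filling → Set
SetFillingOf la a = Fills (IsSetContentOf (length a)) (shape la)

setFillings : List ℕ → List ℕ → List Filling
setFillings la a = fillings (shape la) (boundedLists (setBounds a))

setFillings-sets : ∀ la a → All (SetFillingOf la a) (setFillings la a)
setFillings-sets la a = fillings-Fills (shape la) _ (setBoundedLists-sets a)

isSVST≡isWeakSVST : ∀ {la a S} → SetFillingOf la a S → isSVST (length a) S ≡ isWeakSVST (length a) S
isSVST≡isWeakSVST {a = a} {S} setS = cong (_∧ isWeakSVST (length a) S) (Equivalence.to T-≡ (allSets setS))
  where
  allSets : ∀ {bs F} → Fills (IsSetContentOf (length a)) bs F → T (all (isSet (length a) ∘ proj₂) F)
  allSets []               = _
  allSets ((_ , set) ∷ f) = Equivalence.from T-∧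
    (All.all⁻ _ (All.universal (λ p → ≤⇒≤ᵇ (set p)) (letters (length a))) , allSets f)

⟦hasWeight⟧ : ∀ a F → ⟦ hasWeight a F ⟧ ≡ ∏< (length a) (λ k → ⟦ wt F k + 0 ≡ᵇ mult a k ⟧)
⟦hasWeight⟧ a F = trans (⟦all-applyUpTo⟧ id (length a) (λ k → wt F k ≡ᵇ mult a k))
  (∏<-cong (length a) (λ k → cong (λ m → ⟦ m ≡ᵇ mult a k ⟧) (sym (+-identityʳ (wt F k)))))

liftSum-weak-of-weight : ∀ la a S → SetFillingOf la a S →
  liftSum (weakBounds a) S (λ F → ⟦ isWeakSVST (length a) F ⟧ * ⟦ hasWeight a F ⟧)
    ≡ ⟦ isSVST (length a) S ⟧ * liftCount a S
liftSum-weak-of-weight la a S setS = begin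
  liftSum wb S (λ F → ⟦ isWeakSVST n F ⟧ * ⟦ hasWeight a F ⟧)
    ≡⟨ liftSum-congᴼ n wb S (length-weakBounds a) (λ F over →
         cong₂ _*_ (cong ⟦_⟧ (isWeakSVST-support n over)) (⟦hasWeight⟧ a F)) ⟩
  liftSum wb S (λ F → ⟦ isWeakSVST n S ⟧ * ∏< n (λ k → ⟦ wt F k + 0 ≡ᵇ mult a k ⟧))
    ≡⟨ liftSum-*ˡ wb S ⟦ isWeakSVST n S ⟧ _ ⟩
  ⟦ isWeakSVST n S ⟧ * liftSum wb S (λ F → ∏< n (λ k → ⟦ wt F k + 0 ≡ᵇ mult a k ⟧))
    ≡⟨ cong₂ _*_ (cong ⟦_⟧ (sym (isSVST≡isWeakSVST {la} {a} setS)))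
                 (liftSum-weight a S (λ _ → 0) (All.map proj₂ (Fills-contents setS))) ⟩
  ⟦ isSVST n S ⟧ * liftCount a S
    ∎
  where
  open ≡-Reasoning
  n  = length a
  wb = weakBounds a

coeffK≡∑-liftCount : ∀ la a → coeffK la a ≡ ∑ (setFillings la a) (λ S → ⟦ isSVST (length a) S ⟧ * liftCount a S)
coeffK≡∑-liftCount la a = begin
  coeffK la a
    ≡⟨ length-filterᵇ _ (fillings (shape la) C) ⟩
  ∑ (fillings (shape la) C) (λ F → ⟦ isWeakSVST n F ∧ hasWeight a F ⟧)
    ≡⟨ ∑-cong (fillings (shape la) C) (λ F → ⟦∧⟧ (isWeakSVST n F) (hasWeight a F)) ⟩
  ∑ (fillings (shape la) C) (λ F → ⟦ isWeakSVST n F ⟧ * ⟦ hasWeight a F ⟧)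
    ≡⟨ ∑-fillings-by-support (shape la) (weakBounds a) _ ⟩
  ∑ (setFillings la a) (λ S → liftSum (weakBounds a) S (λ F → ⟦ isWeakSVST n F ⟧ * ⟦ hasWeight a F ⟧))
    ≡⟨ ∑-congᴬ (setFillings-sets la a) (liftSum-weak-of-weight la a) ⟩
  ∑ (setFillings la a) (λ S → ⟦ isSVST n S ⟧ * liftCount a S)
    ∎
  where
  open ≡-Reasoning
  n = length a
  C = boundedLists (weakBounds a)

gpTerm : List ℕ → List ℕ → Filling → ℤ
gpTerm la a F = signPow (total F ∸ size la)
  ℤ.* prodZ (map (λ k → (ySeries ^ˢ wt F k) (mult a k)) (upTo (length a)))

prodZ-ySeries^ : ∀ la a S → SetFillingOf la a S →
  prodZ (map (λ k → (ySeries ^ˢ wt S k) (mult a k)) (upTo (length a))) ≡ signPow (total S) ℤ.* ℤ.+ liftCount a S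
prodZ-ySeries^ la a S setS = begin
  prodZ (map (λ k → (ySeries ^ˢ wt S k) (mult a k)) (upTo n))
    ≡⟨ prodZ-applyUpTo id n _ ⟩
  ∏<ℤ n (λ k → (ySeries ^ˢ wt S k) (mult a k))
    ≡⟨ ∏<ℤ-cong n (λ k → ySeries^-coefficient (mult a k) (wt S k) (mult a k) ≤-refl) ⟩
  ∏<ℤ n (λ k → signPow (wt S k) ℤ.* ℤ.+ compositions (mult a k) (wt S k) 0 (mult a k))
    ≡⟨ ∏<ℤ-signPow-* n (wt S) _ ⟩
  signPow (∑< n (wt S)) ℤ.* ℤ.+ liftCount a S
    ≡⟨ cong (λ m → signPow m ℤ.* ℤ.+ liftCount a S) (∑<-wt n S (All.map proj₁ (Fills-contents setS))) ⟩
  signPow (total S) ℤ.* ℤ.+ liftCount a S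
    ∎
  where
  open ≡-Reasoning
  n = length a

-- total S ∸ size la in gpTerm is a truncated subtraction; it is exact here because
-- every box of a tableau is nonempty.
size≤total : ∀ la n S → Fills (IsSetContentOf n) (shape la) S → T (isWeakSVST n S) → size la ≤ total S
size≤total la n S fills weak = subst (_≤ total S) (trans (Fills-length fills) (length-boxesFrom 0 la))
  (length≤total n S (proj₁ (Equivalence.to T-∧ weak)))
  where
  length-boxesFrom : ∀ i l → length (boxesFrom i l) ≡ sum l
  length-boxesFrom i []      = refl
  length-boxesFrom i (x ∷ l) = trans (List.length-++ (map (λ k → (i , i + k)) (upTo x)))
    (cong₂ _+_ (trans (List.length-map _ (upTo x)) (List.length-upTo x)) (length-boxesFrom (suc i) l))

signed-gpTerm : ∀ la a S → SetFillingOf la a S →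
  signPow (size la) ℤ.* (if isSVST (length a) S then gpTerm la a S else ℤ.0ℤ)
    ≡ ℤ.+ (⟦ isSVST (length a) S ⟧ * liftCount a S)
signed-gpTerm la a S setS with isSVST (length a) S in svst
... | false = ℤ.*-zeroʳ (signPow (size la))
... | true  = begin
  signPow s ℤ.* (signPow (total S ∸ s) ℤ.* prodZ (map (λ k → (ySeries ^ˢ wt S k) (mult a k)) (upTo (length a))))
    ≡⟨ cong (λ z → signPow s ℤ.* (signPow (total S ∸ s) ℤ.* z)) (prodZ-ySeries^ la a S setS) ⟩
  signPow s ℤ.* (signPow (total S ∸ s) ℤ.* (signPow (total S) ℤ.* ℤ.+ liftCount a S))
    ≡⟨ cong (λ m → signPow s ℤ.* (signPow (total S ∸ s) ℤ.* (signPow m ℤ.* ℤ.+ liftCount a S))) (m+[n∸m]≡n s≤total) ⟨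
  signPow s ℤ.* (signPow (total S ∸ s) ℤ.* (signPow (s + (total S ∸ s)) ℤ.* ℤ.+ liftCount a S))
    ≡⟨ signPow-cancel s (total S ∸ s) _ ⟩
  ℤ.+ liftCount a S
    ≡⟨ cong ℤ.+_ (*-identityˡ (liftCount a S)) ⟨
  ℤ.+ (1 * liftCount a S)
    ∎
  where
  open ≡-Reasoning
  s = size la
  s≤total : s ≤ total S
  s≤total = size≤total la (length a) S setS
    (Equivalence.from T-≡ (trans (sym (isSVST≡isWeakSVST {la} {a} setS)) svst))

proposition3p5 : (la : List ℕ) → StrictPartition la → (a : List ℕ) →
  ℤ.+ coeffK la a ≡ signPow (size la) ℤ.* coeffGPsub la a
proposition3p5 la _ a = begin
  ℤ.+ coeffK la a
    ≡⟨ cong ℤ.+_ (coeffK≡∑-liftCount la a) ⟩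
  ℤ.+ ∑ L (λ S → ⟦ isSVST n S ⟧ * liftCount a S)
    ≡⟨ ∑ℤ-pos L _ ⟨
  ∑ℤ L (λ S → ℤ.+ (⟦ isSVST n S ⟧ * liftCount a S))
    ≡⟨ ∑ℤ-congᴬ (setFillings-sets la a) (signed-gpTerm la a) ⟨
  ∑ℤ L (λ S → signPow (size la) ℤ.* (if isSVST n S then gpTerm la a S else ℤ.0ℤ))
    ≡⟨ *-distribˡ-∑ℤ (signPow (size la)) L _ ⟨
  signPow (size la) ℤ.* ∑ℤ L (λ S → if isSVST n S then gpTerm la a S else ℤ.0ℤ)
    ≡⟨ cong (ℤ._*_ (signPow (size la))) (foldr-+-map-filterᵇ (gpTerm la a) (isSVST n) L) ⟨
  signPow (size la) ℤ.* coeffGPsub la a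
    ∎
  where
  open ≡-Reasoning
  n = length a
  L = setFillings la a
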